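{- Let $(G,A,B,C)$ be a canonically-colored path of triangles graph. Then one of the following holds: (i) $\Lambda(G)\le 3$; (ii) $\Lambda(G)=4$ and $G$ contains a bicolored induced $C_4$; (iii) $\Lambda(G)\ge5$ and $G$ contains a bicolored induced $C_4+K_1$.
   Context: A triangle is a set of three pairwise adjacent vertices; $\Lambda(G)$ is the minimum size of a set of vertices meeting every triangle. A 3-colored graph is a quadruple $(G,A,B,C)$ with $A,B,C$ stable sets partitioning $V(G)$; an induced subgraph is bicolored if all its vertices lie in the union of two of $A,B,C$. $C_4+K_1$ is the disjoint union of a 4-cycle and an isolated vertex. Sets $X,Y$ are complete (anticomplete) if every vertex of $X$ is adjacent (non-adjacent) to every vertex of $Y$; matched if disjoint, $|X|=|Y|$, and each vertex of either has a unique neighbor in the other. $G$ is a path of triangles graph if for some $n\ge1$ there is a partition of $V(G)$ into stable sets $X_1,\dots,X_{2n+1}$ with: P1: for $1\le i\le n$ a nonempty $\hat X_{2i}\subseteq X_{2i}$, at least one of $\hat X_{2i},\hat X_{2i+2}$ of cardinality 1; P2: for $1\le i<j\le 2n+1$: (1) if $j-i\equiv2\pmod3$ and some $u\in X_i$, $v\in X_j$ are non-adjacent, then either $i,j$ odd and $j=i+2$, or $i,j$ even and $u\notin\hat X_i$, $v\notin\hat X_j$; (2) if $j-i\not\equiv 2\pmod3$ then $j=i+1$ or $X_i$ is anticomplete to $X_j$; P3: for $1\le i\le n+1$, $X_{2i-1}=L_{2i-1}\cup M_{2i-1}\cup R_{2i-1}$ pairwise disjoint; P4: for $1\le i\le n$,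 $X_{2i}$ anticomplete to $L_{2i-1}\cup R_{2i+1}$; $X_{2i}\setminus\hat X_{2i}$ anticomplete to $M_{2i-1}\cup M_{2i+1}$; every vertex of $X_{2i}\setminus\hat X_{2i}$ adjacent to exactly one end of every edge between $R_{2i-1}$ and $L_{2i+1}$; P5: for $1\le i\le n$ with $|\hat X_{2i}|=1$: (1) $R_{2i-1},L_{2i+1}$ matched and every edge between $M_{2i-1}\cup R_{2i-1}$ and $L_{2i+1}\cup M_{2i+1}$ is between $R_{2i-1}$ and $L_{2i+1}$; (2) the vertex of $\hat X_{2i}$ is complete to $R_{2i-1}\cup M_{2i-1}\cup L_{2i+1}\cup M_{2i+1}$; (3) $L_{2i-1}$ complete to $X_{2i+1}$ and $X_{2i-1}$ complete to $R_{2i+1}$; (4) if $i>1$, $M_{2i-1},\hat X_{2i-2}$ matched; if $i<n$, $M_{2i+1},\hat X_{2i+2}$ matched; P6: for $1\le i\le n$ with $|\hat X_{2i}|>1$: (1) $R_{2i-1}=L_{2i+1}=\emptyset$; (2) $u\in X_{2i-1}$, $v\in X_{2i+1}$ are non-adjacent iff they have the same neighbor in $\hat X_{2i}$; P7: (1) $|\hat X_2|=|\hat X_{2n}|=1$; (2) $L_1=M_1=M_{2n+1}=R_{2n+1}=\emptyset$; (3) if $R_1=\emptyset$ then $n\ge2$ and $|\hat X_4|>1$; if $L_{2n+1}=\emptyset$ then $n\ge 2$ and $|\hat X_{2n-2}|>1$. Such a partition is a good partition. For $k=0,1,2$ let $A_k=\bigcup\{X_i: 1\le i\le 2n+1,\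 i\equiv k\pmod 3\}$. $(G,A,B,C)$ is a canonically-colored path of triangles graph if $G$ has a good partition with $\{A_0,A_1,A_2\}=\{A,B,C\}$. -}

module Defs where

open import Data.Nat using (ℕ; zero; suc; _+_; _*_; _∸_; _≤_; _<_; _%_; _≡ᵇ_)
open import Data.Bool using (Bool; true; false; _∧_; _∨_; not; if_then_else_)
open import Data.Fin using (Fin; toℕ) renaming (zero to fz; suc to fs)
open import Data.Product using (Σ; ∃; ∃-syntax; _×_; _,_)
open import Data.Sum using (_⊎_)
open import Data.Empty using (⊥)
open import Relation.Nullary using (¬_)
open import Relation.Binary.PropositionalEquality using (_≡_; _≢_)
open import Function.Definitions using (Injective)

VSet : ℕ → Set
VSet N = Fin N → Bool

infix 4 _∈_ _∉_
_∈_ : ∀ {N} → Fin N → VSet N → Set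
v ∈ S = S v ≡ true

_∉_ : ∀ {N} → Fin N → VSet N → Set
v ∉ S = ¬ (v ∈ S)

infixl 6 _∪_
_∪_ : ∀ {N} → VSet N → VSet N → VSet N
(S ∪ T) v = S v ∨ T v

card : ∀ {N} → VSet N → ℕ
card {zero} S = 0
card {suc N} S = (if S fz then 1 else 0) + card {N} (λ v → S (fs v))

IsEmpty : ∀ {N} → VSet N → Set
IsEmpty S = ∀ v → v ∉ S

Disjoint : ∀ {N} → VSet N → VSet N → Set
Disjoint S T = ∀ v → v ∈ S → v ∈ T → ⊥

record Graph : Set where
  field
    N          : ℕ
    adj        : Fin N → Fin N → Bool
    adj-sym    : ∀ u v → adj u v ≡ adj v u
    adj-irrefl : ∀ v → adj v v ≡ false

module _ (G : Graph) where
  open Graph G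

  infix 4 _~_
  _~_ : Fin N → Fin N → Set
  u ~ v = adj u v ≡ true

  Stable : VSet N → Set
  Stable S = ∀ u v → u ∈ S → v ∈ S → ¬ (u ~ v)

  Complete : VSet N → VSet N → Set
  Complete X Y = ∀ x y → x ∈ X → y ∈ Y → x ~ y

  Anticomplete : VSet N → VSet N → Set
  Anticomplete X Y = ∀ x y → x ∈ X → y ∈ Y → ¬ (x ~ y)

  UniqueNbr : VSet N → Fin N → Set
  UniqueNbr Y x = Σ (Fin N) λ y → y ∈ Y × x ~ y × (∀ w → w ∈ Y → x ~ w → w ≡ y)

  Matched : VSet N → VSet N → Set
  Matched X Y = Disjoint X Y × card X ≡ card Y
              × (∀ x → x ∈ X → UniqueNbr Y x) × (∀ y → y ∈ Y → UniqueNbr X y)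

  MeetsAllTriangles : VSet N → Set
  MeetsAllTriangles S = ∀ x y z → x ~ y → y ~ z → x ~ z → x ∈ S ⊎ y ∈ S ⊎ z ∈ S

  IsΛ : ℕ → Set
  IsΛ m = (Σ (VSet N) λ S → MeetsAllTriangles S × card S ≡ m)
        × (∀ S → MeetsAllTriangles S → m ≤ card S)

record ThreeColoring (G : Graph) : Set where
  open Graph G
  field
    A B C    : VSet N
    A-stable : Stable G A
    B-stable : Stable G B
    C-stable : Stable G C
    covers   : ∀ v → (A v ∨ B v) ∨ C v ≡ true
    disj-AB  : Disjoint A B
    disj-AC  : Disjoint A C
    disj-BC  : Disjoint B C

data ColPair : Set where
  AB AC BC : ColPair

module _ {G : Graph} (T : ThreeColoring G) where
  open Graph G
  open ThreeColoring T

  pairUnion : ColPair → VSet N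
  pairUnion AB = A ∪ B
  pairUnion AC = A ∪ C
  pairUnion BC = B ∪ C

  colour : Fin 3 → VSet N
  colour fz = A
  colour (fs fz) = B
  colour (fs (fs fz)) = C

  HasBicoloredC4 : Set
  HasBicoloredC4 = Σ ColPair λ p → Σ (Fin N) λ a → Σ (Fin N) λ b → Σ (Fin N) λ c → Σ (Fin N) λ d →
      (a ≢ b × a ≢ c × a ≢ d × b ≢ c × b ≢ d × c ≢ d)
    × (_~_ G a b × _~_ G b c × _~_ G c d × _~_ G d a × ¬ _~_ G a c × ¬ _~_ G b d)
    × (a ∈ pairUnion p × b ∈ pairUnion p × c ∈ pairUnion p × d ∈ pairUnion p)

  HasBicoloredC4K1 : Set
  HasBicoloredC4K1 = Σ ColPair λ p → Σ (Fin N) λ a → Σ (Fin N) λ b → Σ (Fin N) λ c → Σ (Fin N) λ d →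
      Σ (Fin N) λ e →
      (a ≢ b × a ≢ c × a ≢ d × b ≢ c × b ≢ d × c ≢ d × e ≢ a × e ≢ b × e ≢ c × e ≢ d)
    × (_~_ G a b × _~_ G b c × _~_ G c d × _~_ G d a × ¬ _~_ G a c × ¬ _~_ G b d)
    × (¬ _~_ G e a × ¬ _~_ G e b × ¬ _~_ G e c × ¬ _~_ G e d)
    × (a ∈ pairUnion p × b ∈ pairUnion p × c ∈ pairUnion p × d ∈ pairUnion p × e ∈ pairUnion p)

-- A partition X_1,...,X_{2n+1} is given by idx : V → ℕ (v ∈ X_{idx v});
-- hat v = true marks v ∈ X̂_{idx v} (only used for even indices);
-- side v ∈ {L,M,R} gives the partition X_{2i-1} = L ∪ M ∪ R (only used for
-- odd indices).

data Side : Set where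
  L M R : Side

isL isM isR : Side → Bool
isL L = true
isL _ = false
isM M = true
isM _ = false
isR R = true
isR _ = false

module Parts {N : ℕ} (idx : Fin N → ℕ) (hat : Fin N → Bool) (side : Fin N → Side) where
  X : ℕ → VSet N
  X i v = idx v ≡ᵇ i

  Xh : ℕ → VSet N
  Xh i v = (idx v ≡ᵇ i) ∧ hat v

  Xnh : ℕ → VSet N
  Xnh i v = (idx v ≡ᵇ i) ∧ not (hat v)

  Ls Ms Rs : ℕ → VSet N
  Ls i v = (idx v ≡ᵇ i) ∧ isL (side v)
  Ms i v = (idx v ≡ᵇ i) ∧ isM (side v)
  Rs i v = (idx v ≡ᵇ i) ∧ isR (side v)

  Acl : ℕ → VSet N
  Acl k v = (idx v % 3) ≡ᵇ k

ExactlyOne : Set → Set → Set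
ExactlyOne P Q = (P × ¬ Q) ⊎ (¬ P × Q)

module _ (G : Graph) (n : ℕ) (idx : Fin (Graph.N G) → ℕ) (hat : Fin (Graph.N G) → Bool)
         (side : Fin (Graph.N G) → Side) where
  open Graph G
  open Parts idx hat side

  private
    _∼_ = _~_ G

  record IsGoodPartition : Set where
    field
      n≥1    : 1 ≤ n
      range  : ∀ v → 1 ≤ idx v × idx v ≤ 2 * n + 1
      stable : ∀ i → Stable G (X i)
      P1 : ∀ i → 1 ≤ i → i ≤ n →
             1 ≤ card (Xh (2 * i)) × (card (Xh (2 * i)) ≡ 1 ⊎ card (Xh (2 * i + 2)) ≡ 1)
      P2 : ∀ i j → 1 ≤ i → i < j → j ≤ 2 * n + 1 →
             ((j ∸ i) % 3 ≡ 2 → ∀ u v → u ∈ X i → v ∈ X j → ¬ (u ∼ v) →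
                 (i % 2 ≡ 1 × j % 2 ≡ 1 × j ≡ i + 2)
               ⊎ (i % 2 ≡ 0 × j % 2 ≡ 0 × u ∉ Xh i × v ∉ Xh j))
           × ((j ∸ i) % 3 ≢ 2 → j ≡ i + 1 ⊎ Anticomplete G (X i) (X j))
      -- P3 is built into the encoding by `side`
      P4 : ∀ i → 1 ≤ i → i ≤ n →
             Anticomplete G (X (2 * i)) (Ls (2 * i ∸ 1) ∪ Rs (2 * i + 1))
           × Anticomplete G (Xnh (2 * i)) (Ms (2 * i ∸ 1) ∪ Ms (2 * i + 1))
           × (∀ w a b → w ∈ Xnh (2 * i) → a ∈ Rs (2 * i ∸ 1) → b ∈ Ls (2 * i + 1) → a ∼ b →
                ExactlyOne (w ∼ a) (w ∼ b))
      P5 : ∀ i → 1 ≤ i → i ≤ n → card (Xh (2 * i)) ≡ 1 →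
             (Matched G (Rs (2 * i ∸ 1)) (Ls (2 * i + 1))
               × (∀ a b → a ∈ Ms (2 * i ∸ 1) ∪ Rs (2 * i ∸ 1) → b ∈ Ls (2 * i + 1) ∪ Ms (2 * i + 1) →
                    a ∼ b → a ∈ Rs (2 * i ∸ 1) × b ∈ Ls (2 * i + 1)))
           × Complete G (Xh (2 * i))
               (Rs (2 * i ∸ 1) ∪ Ms (2 * i ∸ 1) ∪ Ls (2 * i + 1) ∪ Ms (2 * i + 1))
           × (Complete G (Ls (2 * i ∸ 1)) (X (2 * i + 1)) × Complete G (X (2 * i ∸ 1)) (Rs (2 * i + 1)))
           × (1 < i → Matched G (Ms (2 * i ∸ 1)) (Xh (2 * i ∸ 2)))
           × (i < n → Matched G (Ms (2 * i + 1)) (Xh (2 * i + 2)))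
      P6 : ∀ i → 1 ≤ i → i ≤ n → 1 < card (Xh (2 * i)) →
             (IsEmpty (Rs (2 * i ∸ 1)) × IsEmpty (Ls (2 * i + 1)))
           × (∀ u v → u ∈ X (2 * i ∸ 1) → v ∈ X (2 * i + 1) →
                (¬ (u ∼ v) → Σ (Fin N) λ w → w ∈ Xh (2 * i) × u ∼ w × v ∼ w)
              × ((Σ (Fin N) λ w → w ∈ Xh (2 * i) × u ∼ w × v ∼ w) → ¬ (u ∼ v)))
      P7-1 : card (Xh 2) ≡ 1 × card (Xh (2 * n)) ≡ 1
      P7-2 : IsEmpty (Ls 1) × IsEmpty (Ms 1) × IsEmpty (Ms (2 * n + 1)) × IsEmpty (Rs (2 * n + 1))
      P7-3 : (IsEmpty (Rs 1) → 2 ≤ n × 1 < card (Xh 4))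
           × (IsEmpty (Ls (2 * n + 1)) → 2 ≤ n × 1 < card (Xh (2 * n ∸ 2)))

-- (G,A,B,C) is a canonically-colored path of triangles graph:
-- there is a good partition with {A_0,A_1,A_2} = {A,B,C}
CanonicallyColoredPoT : (G : Graph) → ThreeColoring G → Set
CanonicallyColoredPoT G T =
  Σ ℕ λ n → Σ (Fin (Graph.N G) → ℕ) λ idx → Σ (Fin (Graph.N G) → Bool) λ hat →
  Σ (Fin (Graph.N G) → Side) λ side →
    IsGoodPartition G n idx hat side
  × (Σ (Fin 3 → Fin 3) λ σ → Injective _≡_ _≡_ σ
       × (∀ k v → Parts.Acl idx hat side (toℕ k) v ≡ colour T (σ k) v))

{-# OPTIONS --safe #-}

-- By P2 an edge joins layers i < j with j - i = 1 or j - i ≡ 2 (mod 3), so every triangle lies in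
-- three consecutive layers, and then P4-P6 leave two shapes: (M ∪ R)₂ₛ₋₁, X̂₂ₛ, L₂ₛ₊₁ with |X̂₂ₛ| = 1,
-- or X̂₂ₛ, M₂ₛ₊₁, X̂₂ₛ₊₂.  Since one of two consecutive hat sets is a singleton (P1), the singleton
-- hat sets meet every triangle, whence Λ(G) ≤ n.
-- For n ≥ 4 two vertices of X₁ ∪ X̂₄ and two of X̂₆ ∪ X₉ (supplied by P7 or by the matchings of P5)
-- form an induced C₄ in A₁ ∪ A₀, and every vertex of X₁₃ is anticomplete to it; X₁₃ is nonempty
-- when n ≥ 7, or n = 6 and L₁₃ ≠ ∅.  In the remaining cases with Λ(G) ≥ 5 there is another
-- bicoloured C₄ + K₁ on the layers 1, 5, 8, 10 (n = 6) or 3, 5, 6, 8, 11 (n = 5), unless P7 makes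
-- two hat sets large (n = 6) or, for n = 5 and L₅ = ∅, the hat sets other than X̂₄ already meet
-- every triangle; either way Λ(G) ≤ 4.
module Submission where

open import Defs
open import Data.Nat using (ℕ; zero; suc; _+_; _*_; _∸_; _≤_; _<_; _%_; _≡ᵇ_; z≤n; s≤s)
open import Data.Nat.Properties
open import Data.Nat.DivMod using (%-distribˡ-+)
open import Data.Bool using (Bool; true; false; _∧_; _∨_; not; if_then_else_)
open import Data.Bool.Properties using (∧-conicalˡ; ∧-conicalʳ; ∨-zeroʳ; T-≡) renaming (_≟_ to _≟ᵇ_)
open import Data.Fin using (Fin; toℕ) renaming (zero to fz; suc to fs)
open import Data.Fin.Properties using (any?) renaming (suc-injective to fs-injective)
open import Data.Product using (Σ; ∃-syntax; _×_; _,_; proj₁; proj₂)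
open import Data.Sum using (_⊎_; inj₁; inj₂; [_,_]′; map; map₂; swap)
open import Data.Empty using (⊥; ⊥-elim)
open import Function.Base using (_∘_; _∘₂_; id)
open import Function.Bundles using (Equivalence)
open import Function.Definitions using (Injective)
open import Relation.Nullary using (¬_; yes; no; contradiction)
open import Relation.Nullary.Decidable using (True; False; toWitness; toWitnessFalse; _×-dec_; decidable-stable)
open import Relation.Binary.PropositionalEquality using (_≡_; _≢_; refl; sym; trans; cong; cong₂; subst; module ≡-Reasoning)
open import Relation.Binary.Definitions using (tri<; tri≈; tri>)

≡ᵇ-true⇒≡ : ∀ {m n} → (m ≡ᵇ n) ≡ true → m ≡ n
≡ᵇ-true⇒≡ {m} {n} e = ≡ᵇ⇒≡ m n (Equivalence.from T-≡ e)

≡⇒≡ᵇ-true : ∀ {m n} → m ≡ n → (m ≡ᵇ n) ≡ true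
≡⇒≡ᵇ-true {m} {n} e = Equivalence.to T-≡ (≡⇒≡ᵇ m n e)

>1⇒≡ᵇ1-false : ∀ {c} → 1 < c → (c ≡ᵇ 1) ≡ false
>1⇒≡ᵇ1-false (s≤s (s≤s _)) = refl

-- Membership facts are stated on Booleans: from v ∈ S ∪ T, which unfolds to S v ∨ T v ≡ true,
-- the unifier can recover S v and T v but not S and T.
∧-intro : ∀ {a b} → a ≡ true → b ≡ true → a ∧ b ≡ true
∧-intro refl refl = refl

∨-introˡ : ∀ {a b} → a ≡ true → a ∨ b ≡ true
∨-introˡ refl = refl

∨-introʳ : ∀ {a b} → b ≡ true → a ∨ b ≡ true
∨-introʳ {a} refl = ∨-zeroʳ a

∨-elim : ∀ {a b} → a ∨ b ≡ true → a ≡ true ⊎ b ≡ true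
∨-elim {true}  _ = inj₁ refl
∨-elim {false} e = inj₂ e

¬both : ∀ {A B : Set} → ExactlyOne A B → A → B → ⊥
¬both (inj₁ (_ , ¬b)) _ b = ¬b b
¬both (inj₂ (¬a , _)) a _ = ¬a a

⊎-swap₁₂ : ∀ {A B C : Set} → A ⊎ B ⊎ C → B ⊎ A ⊎ C
⊎-swap₁₂ = [ inj₂ ∘ inj₁ , [ inj₁ , inj₂ ∘ inj₂ ]′ ]′

⊎-swap₂₃ : ∀ {A B C : Set} → A ⊎ B ⊎ C → A ⊎ C ⊎ B
⊎-swap₂₃ = map₂ swap

module _ {N : ℕ} where

  ∅ : VSet N
  ∅ _ = false

  infix 4 _⊆_
  _⊆_ : VSet N → VSet N → Set
  S ⊆ T = ∀ {v} → v ∈ S → v ∈ T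

  Nonempty : VSet N → Set
  Nonempty S = ∃[ v ] v ∈ S

  nonempty? : (S : VSet N) → Nonempty S ⊎ IsEmpty S
  nonempty? S with any? (λ v → S v ≟ᵇ true)
  ... | yes found = inj₁ found
  ... | no none   = inj₂ (λ v v∈S → none (v , v∈S))

card-empty : ∀ {N} {S : VSet N} → IsEmpty S → card S ≡ 0
card-empty {zero}          _     = refl
card-empty {suc N} {S} empty with S fz in e
... | true  = ⊥-elim (empty fz e)
... | false = card-empty (empty ∘ fs)

card-∪ : ∀ {N} (S T : VSet N) → card (S ∪ T) ≤ card S + card T
card-∪ {zero}  S T = z≤n
card-∪ {suc N} S T with S fz | T fz | card-∪ (S ∘ fs) (T ∘ fs)
... | true  | true  | ih = s≤s (≤-trans ih (+-monoʳ-≤ (card (S ∘ fs)) (n≤1+n _)))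
... | true  | false | ih = s≤s ih
... | false | true  | ih = ≤-trans (s≤s ih) (≤-reflexive (sym (+-suc _ _)))
... | false | false | ih = ih

card>0⇒nonempty : ∀ {N} {S : VSet N} → 1 ≤ card S → Nonempty S
card>0⇒nonempty {S = S} 1≤card with nonempty? S
... | inj₁ found = found
... | inj₂ empty = contradiction (card-empty empty) (>⇒≢ 1≤card)

card>1⇒two : ∀ {N} {S : VSet N} → 1 < card S → ∃[ u ] ∃[ v ] u ≢ v × u ∈ S × v ∈ S
card>1⇒two {zero} ()
card>1⇒two {suc N} {S} 1<card with S fz in e
... | true  = let (v , v∈S) = card>0⇒nonempty (≤-pred 1<card) in fz , fs v , (λ ()) , e , v∈S
... | false = let (u , v , u≢v , u∈S , v∈S) = card>1⇒two 1<card
              in fs u , fs v , u≢v ∘ fs-injective , u∈S , v∈S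

count : (ℕ → Bool) → ℕ → ℕ
count K zero    = 0
count K (suc k) = if K (suc k) then suc (count K k) else count K k

count-≤ : ∀ K k → count K k ≤ k
count-≤ K zero = z≤n
count-≤ K (suc k) with K (suc k)
... | true  = s≤s (count-≤ K k)
... | false = m≤n⇒m≤1+n (count-≤ K k)

count-full : ∀ {K} k → k ≤ count K k → ∀ {j} → 1 ≤ j → j ≤ k → K j ≡ true
count-full zero _ 1≤j j≤0 = contradiction (≤-trans 1≤j j≤0) λ ()
count-full {K} (suc k) full {j} 1≤j j≤k with K (suc k) in e | j ≟ suc k
... | true  | yes refl = e
... | true  | no j≢k  = count-full k (≤-pred full) 1≤j (≤-pred (≤∧≢⇒< j≤k j≢k))
... | false | _       = contradiction (≤-trans full (count-≤ K k)) (<⇒≱ ≤-refl)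

count-mono : ∀ {K K′} → (∀ j → K j ≡ true → K′ j ≡ true) → ∀ k → count K k ≤ count K′ k
count-mono K⇒K′ zero = z≤n
count-mono {K} {K′} K⇒K′ (suc k) with K (suc k) in e | K′ (suc k) in e′
... | true  | true  = s≤s (count-mono K⇒K′ k)
... | true  | false = contradiction (trans (sym (K⇒K′ (suc k) e)) e′) λ ()
... | false | true  = m≤n⇒m≤1+n (count-mono K⇒K′ k)
... | false | false = count-mono K⇒K′ k

count-avoiding : ∀ {K a b} → K a ≡ false → K b ≡ false → ∀ k →
                 count K k ≤ count (λ j → not ((j ≡ᵇ a) ∨ (j ≡ᵇ b))) k
count-avoiding {K} {a} {b} Ka Kb = count-mono avoids
  where
  avoids : ∀ j → K j ≡ true → not ((j ≡ᵇ a) ∨ (j ≡ᵇ b)) ≡ true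
  avoids j Kj with j ≡ᵇ a in ea | j ≡ᵇ b in eb
  ... | true  | _     = contradiction (trans (sym Kj) (subst (λ i → K i ≡ false) (sym (≡ᵇ-true⇒≡ ea)) Ka)) λ ()
  ... | false | true  = contradiction (trans (sym Kj) (subst (λ i → K i ≡ false) (sym (≡ᵇ-true⇒≡ eb)) Kb)) λ ()
  ... | false | false = refl

-- Arithmetic of layer indices

Admissible : ℕ → Set
Admissible d = d ≡ 1 ⊎ d % 3 ≡ 2

residue-sum : ∀ d₁ d₂ {r₁ r₂} → d₁ % 3 ≡ r₁ → d₂ % 3 ≡ r₂ → (d₁ + d₂) % 3 ≡ (r₁ + r₂) % 3
residue-sum d₁ d₂ e₁ e₂ = trans (%-distribˡ-+ d₁ d₂ 3) (cong₂ (λ a b → (a + b) % 3) e₁ e₂)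

admissible-sum : ∀ {d₁ d₂} → 1 ≤ d₁ → 1 ≤ d₂ → Admissible d₁ → Admissible d₂ → Admissible (d₁ + d₂) →
                 d₁ ≡ 1 × d₂ ≡ 1
admissible-sum _ _ (inj₁ refl) (inj₁ refl) _ = refl , refl
admissible-sum {d₁} (s≤s _) (s≤s _) _ _ (inj₁ sum≡1) = contradiction (trans (sym (+-suc d₁ _)) sum≡1) λ ()
admissible-sum {d₂ = d₂} _ _ (inj₁ refl) (inj₂ r₂) (inj₂ r) =
  contradiction (trans (sym (residue-sum 1 d₂ refl r₂)) r) λ ()
admissible-sum {d₁} _ _ (inj₂ r₁) (inj₁ refl) (inj₂ r) =
  contradiction (trans (sym (residue-sum d₁ 1 r₁ refl)) r) λ ()
admissible-sum {d₁} {d₂} _ _ (inj₂ r₁) (inj₂ r₂) (inj₂ r) =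
  contradiction (trans (sym (residue-sum d₁ d₂ r₁ r₂)) r) λ ()

∸-split : ∀ {i j k} → i ≤ j → j ≤ k → k ∸ i ≡ (k ∸ j) + (j ∸ i)
∸-split {i} {j} {k} i≤j j≤k = begin
  k ∸ i             ≡⟨ cong (_∸ i) (sym (m∸n+n≡m j≤k)) ⟩
  (k ∸ j) + j ∸ i   ≡⟨ +-∸-assoc (k ∸ j) i≤j ⟩
  (k ∸ j) + (j ∸ i) ∎
  where open ≡-Reasoning

∸≡1⇒≡suc : ∀ {i j} → i ≤ j → j ∸ i ≡ 1 → j ≡ suc i
∸≡1⇒≡suc {i} i≤j gap = trans (sym (m∸n+n≡m i≤j)) (cong (_+ i) gap)

parity : ∀ i → (∃[ t ] i ≡ 2 * t) ⊎ (∃[ t ] i ≡ suc (2 * t))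
parity zero = inj₁ (0 , refl)
parity (suc i) with parity i
... | inj₁ (t , i≡2t)   = inj₂ (t , cong suc i≡2t)
... | inj₂ (t , i≡2t+1) = inj₁ (suc t , trans (cong suc i≡2t+1) (sym (*-suc 2 t)))

2s+1≡2[1+s]∸1 : ∀ s → 2 * s + 1 ≡ 2 * suc s ∸ 1
2s+1≡2[1+s]∸1 s = trans (+-comm (2 * s) 1) (sym (cong (_∸ 1) (*-suc 2 s)))

2s+2≡2[1+s] : ∀ s → 2 * s + 2 ≡ 2 * suc s
2s+2≡2[1+s] s = trans (+-comm (2 * s) 2) (sym (*-suc 2 s))

2a≤2b+1⇒a≤b : ∀ {a b} → 2 * a ≤ 2 * b + 1 → a ≤ b
2a≤2b+1⇒a≤b {a} {b} le = ≤-pred (*-cancelˡ-< 2 a (suc b) (≤-trans (s≤s le) (≤-reflexive 2b+2≡2[1+b])))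
  where
  2b+2≡2[1+b] : suc (2 * b + 1) ≡ 2 * suc b
  2b+2≡2[1+b] = trans (cong suc (+-comm (2 * b) 1)) (sym (*-suc 2 b))

module Adjacency (G : Graph) where
  open Graph G

  infix 4 _∼_
  _∼_ : Fin N → Fin N → Set
  _∼_ = _~_ G

  ∼-sym : ∀ {u v} → u ∼ v → v ∼ u
  ∼-sym {u} {v} u∼v = trans (adj-sym v u) u∼v

  ∼⇒≢ : ∀ {u v} → u ∼ v → u ≢ v
  ∼⇒≢ {u} u∼u refl = contradiction (trans (sym (adj-irrefl u)) u∼u) λ ()

  Hit : VSet N → Fin N → Fin N → Fin N → Set
  Hit S x y z = x ∈ S ⊎ y ∈ S ⊎ z ∈ S

  module _ (rank : Fin N → ℕ) (rank-≢ : ∀ {u v} → u ∼ v → rank u ≢ rank v) {S : VSet N}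
           (sorted : ∀ {x y z} → x ∼ y → y ∼ z → x ∼ z → rank x < rank y → rank y < rank z → Hit S x y z)
           where

    private
      hit-lowest-first : ∀ {x y z} → x ∼ y → y ∼ z → x ∼ z → rank x < rank y → Hit S x y z
      hit-lowest-first x∼y y∼z x∼z x<y with <-cmp (rank _) (rank _)
      ... | tri< y<z _ _ = sorted x∼y y∼z x∼z x<y y<z
      ... | tri≈ _ y≡z _ = contradiction y≡z (rank-≢ y∼z)
      ... | tri> _ _ z<y with <-cmp (rank _) (rank _)
      ...   | tri< x<z _ _ = ⊎-swap₂₃ (sorted x∼z (∼-sym y∼z) x∼y x<z z<y)
      ...   | tri≈ _ x≡z _ = contradiction x≡z (rank-≢ x∼z)
      ...   | tri> _ _ z<x = ⊎-swap₂₃ (⊎-swap₁₂ (sorted (∼-sym x∼z) x∼y (∼-sym y∼z) z<x x<y))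

    sorted⇒MeetsAllTriangles : MeetsAllTriangles G S
    sorted⇒MeetsAllTriangles x y z x∼y y∼z x∼z with <-cmp (rank x) (rank y)
    ... | tri< x<y _ _ = hit-lowest-first x∼y y∼z x∼z x<y
    ... | tri≈ _ x≡y _ = contradiction x≡y (rank-≢ x∼y)
    ... | tri> _ _ y<x = ⊎-swap₁₂ (hit-lowest-first (∼-sym x∼y) x∼z y∼z y<x)

record InducedC4 (G : Graph) : Set where
  open Graph G
  open Adjacency G
  field
    a₁ a₂ b₁ b₂ : Fin N
    a₁≢a₂ : a₁ ≢ a₂
    b₁≢b₂ : b₁ ≢ b₂
    a₁∼b₁ : a₁ ∼ b₁
    a₁∼b₂ : a₁ ∼ b₂
    a₂∼b₁ : a₂ ∼ b₁
    a₂∼b₂ : a₂ ∼ b₂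
    a₁≁a₂ : ¬ a₁ ∼ a₂
    b₁≁b₂ : ¬ b₁ ∼ b₂

module _ {G : Graph} (T : ThreeColoring G) where
  open Adjacency G

  colourPair : (c d : Fin 3) → c ≢ d → Σ ColPair λ p → colour T c ⊆ pairUnion T p × colour T d ⊆ pairUnion T p
  colourPair fz           fz           c≢d = contradiction refl c≢d
  colourPair fz           (fs fz)      _   = AB , ∨-introˡ , ∨-introʳ
  colourPair fz           (fs (fs fz)) _   = AC , ∨-introˡ , ∨-introʳ
  colourPair (fs fz)      fz           _   = AB , ∨-introʳ , ∨-introˡ
  colourPair (fs fz)      (fs fz)      c≢d = contradiction refl c≢d
  colourPair (fs fz)      (fs (fs fz)) _   = BC , ∨-introˡ , ∨-introʳ
  colourPair (fs (fs fz)) fz           _   = AC , ∨-introʳ , ∨-introˡ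
  colourPair (fs (fs fz)) (fs fz)      _   = BC , ∨-introʳ , ∨-introˡ
  colourPair (fs (fs fz)) (fs (fs fz)) c≢d = contradiction refl c≢d

  module _ (c : InducedC4 G) (p : ColPair) where
    open InducedC4 c

    Bicoloured : Set
    Bicoloured = a₁ ∈ pairUnion T p × a₂ ∈ pairUnion T p × b₁ ∈ pairUnion T p × b₂ ∈ pairUnion T p

    InducedC4⇒HasBicoloredC4 : Bicoloured → HasBicoloredC4 T
    InducedC4⇒HasBicoloredC4 (a₁∈p , a₂∈p , b₁∈p , b₂∈p) =
      p , a₁ , b₁ , a₂ , b₂
      , (∼⇒≢ a₁∼b₁ , a₁≢a₂ , ∼⇒≢ a₁∼b₂ , ∼⇒≢ (∼-sym a₂∼b₁) , b₁≢b₂ , ∼⇒≢ a₂∼b₂)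
      , (a₁∼b₁ , ∼-sym a₂∼b₁ , a₂∼b₂ , ∼-sym a₁∼b₂ , a₁≁a₂ , b₁≁b₂)
      , (a₁∈p , b₁∈p , a₂∈p , b₂∈p)

    -- e is distinct from the cycle: each cycle vertex has a neighbour that e misses.
    InducedC4⇒HasBicoloredC4K1 : Bicoloured → ∀ {e} → ¬ e ∼ a₁ → ¬ e ∼ a₂ → ¬ e ∼ b₁ → ¬ e ∼ b₂ →
                                 e ∈ pairUnion T p → HasBicoloredC4K1 T
    InducedC4⇒HasBicoloredC4K1 (a₁∈p , a₂∈p , b₁∈p , b₂∈p) {e} e≁a₁ e≁a₂ e≁b₁ e≁b₂ e∈p =
      p , a₁ , b₁ , a₂ , b₂ , e
      , (∼⇒≢ a₁∼b₁ , a₁≢a₂ , ∼⇒≢ a₁∼b₂ , ∼⇒≢ (∼-sym a₂∼b₁) , b₁≢b₂ , ∼⇒≢ a₂∼b₂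
        , differs e≁b₁ a₁∼b₁ , differs e≁a₁ (∼-sym a₁∼b₁) , differs e≁b₁ a₂∼b₁ , differs e≁a₁ (∼-sym a₁∼b₂))
      , (a₁∼b₁ , ∼-sym a₂∼b₁ , a₂∼b₂ , ∼-sym a₁∼b₂ , a₁≁a₂ , b₁≁b₂)
      , (e≁a₁ , e≁b₁ , e≁a₂ , e≁b₂)
      , (a₁∈p , b₁∈p , a₂∈p , b₂∈p , e∈p)
      where
      differs : ∀ {u w} → ¬ e ∼ w → u ∼ w → e ≢ u
      differs e≁w u∼w refl = e≁w u∼w

module Layers {N : ℕ} (idx : Fin N → ℕ) (hat : Fin N → Bool) (side : Fin N → Side) where
  open Parts idx hat side public

  ∈X⇒idx≡ : ∀ {v i} → v ∈ X i → idx v ≡ i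
  ∈X⇒idx≡ = ≡ᵇ-true⇒≡

  idx≡⇒∈X : ∀ {v i} → idx v ≡ i → v ∈ X i
  idx≡⇒∈X = ≡⇒≡ᵇ-true

  relabel : ∀ (F : ℕ → VSet N) {i j v} → i ≡ j → v ∈ F i → v ∈ F j
  relabel F {v = v} = subst (λ k → v ∈ F k)

  layer-distinct : ∀ {u v} i j → u ∈ X i → v ∈ X j → {_ : False (i ≟ j)} → u ≢ v
  layer-distinct i j u∈ v∈ {i≢j} refl = toWitnessFalse i≢j (trans (sym (∈X⇒idx≡ u∈)) (∈X⇒idx≡ v∈))

  Xh⊆X : ∀ {v i} → v ∈ Xh i → v ∈ X i
  Xh⊆X = ∧-conicalˡ _ _

  Ls⊆X : ∀ {v i} → v ∈ Ls i → v ∈ X i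
  Ls⊆X = ∧-conicalˡ _ _

  Ms⊆X : ∀ {v i} → v ∈ Ms i → v ∈ X i
  Ms⊆X = ∧-conicalˡ _ _

  Rs⊆X : ∀ {v i} → v ∈ Rs i → v ∈ X i
  Rs⊆X = ∧-conicalˡ _ _

  Ms∩Rs : ∀ {v i j} → v ∈ Ms i → v ∈ Rs j → ⊥
  Ms∩Rs {v} v∈M v∈R = sides-differ {side v} (∧-conicalʳ _ _ v∈M) (∧-conicalʳ _ _ v∈R)
    where
    sides-differ : ∀ {s} → isM s ≡ true → isR s ≡ true → ⊥
    sides-differ {M} _ ()

  hat-split : ∀ {v i} → v ∈ X i → v ∈ Xh i ⊎ v ∈ Xnh i
  hat-split {v} v∈ with hat v
  ... | true  = inj₁ (∧-intro v∈ refl)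
  ... | false = inj₂ (∧-intro v∈ refl)

  side-split : ∀ {v i} → v ∈ X i → v ∈ Ls i ⊎ v ∈ Ms i ⊎ v ∈ Rs i
  side-split {v} v∈ with side v
  ... | L = inj₁ (∧-intro v∈ refl)
  ... | M = inj₂ (inj₁ (∧-intro v∈ refl))
  ... | R = inj₂ (inj₂ (∧-intro v∈ refl))

  ∉Ls⇒∈Ms∪Rs : ∀ {v i} → v ∈ X i → v ∉ Ls i → v ∈ Ms i ∪ Rs i
  ∉Ls⇒∈Ms∪Rs v∈ v∉L = [ (λ v∈L → contradiction v∈L v∉L) , [ ∨-introˡ , ∨-introʳ ]′ ]′ (side-split v∈)

  ∉Rs⇒∈Ls∪Ms : ∀ {v i} → v ∈ X i → v ∉ Rs i → v ∈ Ls i ∪ Ms i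
  ∉Rs⇒∈Ls∪Ms v∈ v∉R = [ ∨-introˡ , [ ∨-introʳ , (λ v∈R → contradiction v∈R v∉R) ]′ ]′ (side-split v∈)

  singleton? : ℕ → Bool
  singleton? j = card (Xh (2 * j)) ≡ᵇ 1

  Hats : (ℕ → Bool) → ℕ → VSet N
  Hats K zero    = ∅
  Hats K (suc k) = if K (suc k) then Hats K k ∪ Xh (2 * suc k) else Hats K k

  ∈-Hats : ∀ {K k j h} → 1 ≤ j → j ≤ k → K j ≡ true → h ∈ Xh (2 * j) → h ∈ Hats K k
  ∈-Hats {k = zero} 1≤j j≤0 = contradiction (≤-trans 1≤j j≤0) λ ()
  ∈-Hats {K} {suc k} {j} 1≤j j≤k Kj h∈ with j ≟ suc k
  ... | yes refl rewrite Kj = ∨-introʳ h∈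
  ... | no j≢k with K (suc k)
  ...   | true  = ∨-introˡ (∈-Hats 1≤j (≤-pred (≤∧≢⇒< j≤k j≢k)) Kj h∈)
  ...   | false = ∈-Hats 1≤j (≤-pred (≤∧≢⇒< j≤k j≢k)) Kj h∈

  card-Hats : ∀ {K} k → (∀ j → 1 ≤ j → j ≤ k → K j ≡ true → card (Xh (2 * j)) ≤ 1) →
              card (Hats K k) ≤ count K k
  card-Hats {K} zero _ = ≤-reflexive (card-empty {S = Hats K zero} λ _ ())
  card-Hats {K} (suc k) small with K (suc k) in e
  ... | true  = ≤-trans (card-∪ (Hats K k) (Xh (2 * suc k)))
                        (≤-trans (+-mono-≤ (card-Hats k (λ j 1≤j j≤k → small j 1≤j (m≤n⇒m≤1+n j≤k)))
                                           (small (suc k) (s≤s z≤n) ≤-refl e))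
                                 (≤-reflexive (+-comm (count K k) 1)))
  ... | false = card-Hats k (λ j 1≤j j≤k → small j 1≤j (m≤n⇒m≤1+n j≤k))

module Colours {G : Graph} (T : ThreeColoring G)
               (idx : Fin (Graph.N G) → ℕ) (hat : Fin (Graph.N G) → Bool) (side : Fin (Graph.N G) → Side)
               (σ : Fin 3 → Fin 3) (σ-injective : Injective _≡_ _≡_ σ)
               (σ-colours : ∀ k v → Parts.Acl idx hat side (toℕ k) v ≡ colour T (σ k) v) where
  open Layers idx hat side

  layer-colour : ∀ {v i} k → v ∈ X i → i % 3 ≡ toℕ k → v ∈ colour T (σ k)
  layer-colour {v} k v∈ i≡k = trans (sym (σ-colours k v)) (≡⇒≡ᵇ-true (trans (cong (_% 3) (∈X⇒idx≡ v∈)) i≡k))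

  bicolour : (k l : Fin 3) → k ≢ l →
             Σ ColPair λ p → ∀ {v i} → v ∈ X i → i % 3 ≡ toℕ k ⊎ i % 3 ≡ toℕ l → v ∈ pairUnion T p
  bicolour k l k≢l with colourPair T (σ k) (σ l) (k≢l ∘ σ-injective)
  ... | p , k⊆p , l⊆p = p , λ v∈ → [ k⊆p ∘ layer-colour k v∈ , l⊆p ∘ layer-colour l v∈ ]′

-- Good partitions

module GoodPartition {G : Graph} {n : ℕ} {idx : Fin (Graph.N G) → ℕ} {hat side}
                     (gp : IsGoodPartition G n idx hat side) where
  open Graph G
  open Adjacency G
  open Layers idx hat side
  open IsGoodPartition gp

  layer≥1 : ∀ {v i} → v ∈ X i → 1 ≤ i
  layer≥1 {v} v∈ = subst (1 ≤_) (∈X⇒idx≡ v∈) (proj₁ (range v))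

  layer≤ : ∀ {v i} → v ∈ X i → i ≤ 2 * n + 1
  layer≤ {v} v∈ = subst (_≤ 2 * n + 1) (∈X⇒idx≡ v∈) (proj₂ (range v))

  layer-stable : ∀ {u v} i → u ∈ X i → v ∈ X i → ¬ u ∼ v
  layer-stable i = stable i _ _

  ∼⇒idx≢ : ∀ {u v} → u ∼ v → idx u ≢ idx v
  ∼⇒idx≢ {u} u∼v u≡v = layer-stable (idx u) (idx≡⇒∈X refl) (idx≡⇒∈X (sym u≡v)) u∼v

  forced-adjacent : ∀ {u v i j} → u ∈ X i → v ∈ X j → i < j → (j ∸ i) % 3 ≡ 2 →
                    ¬ (i % 2 ≡ 1 × j % 2 ≡ 1 × j ≡ i + 2) →
                    ¬ (i % 2 ≡ 0 × j % 2 ≡ 0 × u ∉ Xh i × v ∉ Xh j) → u ∼ v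
  forced-adjacent {u} {v} {i} {j} u∈ v∈ i<j gap ¬odd ¬even = decidable-stable (adj u v ≟ᵇ true) λ u≁v →
    [ ¬odd , ¬even ]′ (proj₁ (P2 i j (layer≥1 u∈) i<j (layer≤ v∈)) gap u v u∈ v∈ u≁v)

  -- The guards are closed decidable conditions, discharged by evaluation when i and j are literals.
  adjacent : ∀ {u v} i j → u ∈ X i → v ∈ X j →
             {_ : True (i <? j)} {_ : True ((j ∸ i) % 3 ≟ 2)} {_ : False (j ≟ i + 2)}
             {_ : False (i % 2 ≟ 0 ×-dec j % 2 ≟ 0)} → u ∼ v
  adjacent i j u∈ v∈ {i<j} {gap} {j≢i+2} {¬even} =
    forced-adjacent u∈ v∈ (toWitness i<j) (toWitness gap)
      (λ (_ , _ , j≡i+2) → toWitnessFalse j≢i+2 j≡i+2)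
      (λ (i-even , j-even , _) → toWitnessFalse ¬even (i-even , j-even))

  adjacent-hats : ∀ {u v} i j → u ∈ Xh i → v ∈ Xh j →
                  {_ : True (i <? j)} {_ : True ((j ∸ i) % 3 ≟ 2)} {_ : True (i % 2 ≟ 0)} → u ∼ v
  adjacent-hats i j u∈ v∈ {i<j} {gap} {i-even} =
    forced-adjacent (Xh⊆X u∈) (Xh⊆X v∈) (toWitness i<j) (toWitness gap)
      (λ (i-odd , _) → 0≢1+n (trans (sym (toWitness i-even)) i-odd))
      (λ (_ , _ , u∉ , _) → u∉ u∈)

  nonadjacent : ∀ {u v} i j → u ∈ X i → v ∈ X j →
                {_ : True (i <? j)} {_ : False ((j ∸ i) % 3 ≟ 2)} {_ : False (j ≟ i + 1)} → ¬ u ∼ v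
  nonadjacent i j u∈ v∈ {i<j} {gap} {j≢i+1} =
    [ (λ j≡i+1 → contradiction j≡i+1 (toWitnessFalse j≢i+1)) , (λ anti → anti _ _ u∈ v∈) ]′
      (proj₂ (P2 i j (layer≥1 u∈) (toWitness i<j) (layer≤ v∈)) (toWitnessFalse gap))

  edge-gap : ∀ {u v} → u ∼ v → idx u < idx v → Admissible (idx v ∸ idx u)
  edge-gap {u} {v} u∼v u<v with (idx v ∸ idx u) % 3 ≟ 2
  ... | yes gap = inj₂ gap
  ... | no gap  = [ (λ v≡u+1 → inj₁ (trans (cong (_∸ idx u) v≡u+1) (m+n∸m≡n (idx u) 1)))
                  , (λ anti → contradiction u∼v (anti u v (idx≡⇒∈X refl) (idx≡⇒∈X refl))) ]′
                  (proj₂ (P2 (idx u) (idx v) (proj₁ (range u)) u<v (proj₂ (range v))) gap)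

  sorted-triangle-consecutive : ∀ {x y z} → x ∼ y → y ∼ z → x ∼ z → idx x < idx y → idx y < idx z →
                                idx y ≡ suc (idx x) × idx z ≡ suc (idx y)
  sorted-triangle-consecutive x∼y y∼z x∼z x<y y<z =
    let z-y≡1 , y-x≡1 = admissible-sum (m<n⇒0<n∸m y<z) (m<n⇒0<n∸m x<y) (edge-gap y∼z y<z) (edge-gap x∼y x<y)
                          (subst Admissible (∸-split (<⇒≤ x<y) (<⇒≤ y<z)) (edge-gap x∼z (<-trans x<y y<z)))
    in ∸≡1⇒≡suc (<⇒≤ x<y) y-x≡1 , ∸≡1⇒≡suc (<⇒≤ y<z) z-y≡1

  triangle-through-hat : ∀ {x y z} s → 1 ≤ s → s ≤ n →
                         x ∈ X (2 * s ∸ 1) → y ∈ X (2 * s) → z ∈ X (2 * s + 1) → x ∼ y → y ∼ z → x ∼ z →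
                         card (Xh (2 * s)) ≡ 1 × y ∈ Xh (2 * s) × z ∈ Ls (2 * s + 1)
  triangle-through-hat {x} {y} {z} s 1≤s s≤n x∈ y∈ z∈ x∼y y∼z x∼z =
    [ y-hat , (λ y∈nh → contradiction y∈nh y-not-non-hat) ]′ (hat-split y∈)
    where
    P4s = P4 s 1≤s s≤n
    hat-layer-anticomplete = proj₁ P4s
    non-hat-anticomplete-M = proj₁ (proj₂ P4s)
    non-hat-sees-one-end   = proj₂ (proj₂ P4s)

    x∈M∪R : x ∈ Ms (2 * s ∸ 1) ∪ Rs (2 * s ∸ 1)
    x∈M∪R = ∉Ls⇒∈Ms∪Rs x∈ λ x∈L → hat-layer-anticomplete y x y∈ (∨-introˡ x∈L) (∼-sym x∼y)

    z∈L∪M : z ∈ Ls (2 * s + 1) ∪ Ms (2 * s + 1)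
    z∈L∪M = ∉Rs⇒∈Ls∪Ms z∈ λ z∈R → hat-layer-anticomplete y z y∈ (∨-introʳ z∈R) y∼z

    y-not-non-hat : y ∉ Xnh (2 * s)
    y-not-non-hat y∈nh with ∨-elim x∈M∪R | ∨-elim z∈L∪M
    ... | inj₁ x∈M | _        = non-hat-anticomplete-M y x y∈nh (∨-introˡ x∈M) (∼-sym x∼y)
    ... | inj₂ _   | inj₂ z∈M = non-hat-anticomplete-M y z y∈nh (∨-introʳ z∈M) y∼z
    ... | inj₂ x∈R | inj₁ z∈L = ¬both (non-hat-sees-one-end y x z y∈nh x∈R z∈L x∼z) (∼-sym x∼y) y∼z

    y-hat : y ∈ Xh (2 * s) → card (Xh (2 * s)) ≡ 1 × y ∈ Xh (2 * s) × z ∈ Ls (2 * s + 1)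
    y-hat y∈h with m≤n⇒m<n∨m≡n (proj₁ (P1 s 1≤s s≤n))
    ... | inj₁ 1<card = contradiction x∼z (proj₂ (proj₂ (P6 s 1≤s s≤n 1<card) x z x∈ z∈) (y , y∈h , x∼y , ∼-sym y∼z))
    ... | inj₂ 1≡card = sym 1≡card , y∈h , proj₂ (proj₂ (proj₁ (P5 s 1≤s s≤n (sym 1≡card))) x z x∈M∪R z∈L∪M x∼z)

  triangle-between-hats : ∀ {x y z} s → 1 ≤ s → suc s ≤ n →
                          x ∈ X (2 * s) → y ∈ X (2 * s + 1) → z ∈ X (2 * suc s) → x ∼ y → y ∼ z →
                          x ∈ Xh (2 * s) × z ∈ Xh (2 * suc s)
  triangle-between-hats {x} {y} {z} s 1≤s s<n x∈ y∈ z∈ x∼y y∼z with side-split y∈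
  ... | inj₁ y∈L =
    contradiction (∼-sym y∼z) (proj₁ (P4 (suc s) (s≤s z≤n) s<n) z y z∈ (∨-introˡ (relabel Ls (2s+1≡2[1+s]∸1 s) y∈L)))
  ... | inj₂ (inj₂ y∈R) = contradiction x∼y (proj₁ (P4 s 1≤s (<⇒≤ s<n)) x y x∈ (∨-introʳ y∈R))
  ... | inj₂ (inj₁ y∈M) = [ id , x-not-non-hat ]′ (hat-split x∈) , [ id , z-not-non-hat ]′ (hat-split z∈)
    where
    x-not-non-hat : x ∈ Xnh (2 * s) → x ∈ Xh (2 * s)
    x-not-non-hat x∈nh = contradiction x∼y (proj₁ (proj₂ (P4 s 1≤s (<⇒≤ s<n))) x y x∈nh (∨-introʳ y∈M))
    z-not-non-hat : z ∈ Xnh (2 * suc s) → z ∈ Xh (2 * suc s)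
    z-not-non-hat z∈nh = contradiction (∼-sym y∼z)
      (proj₁ (proj₂ (P4 (suc s) (s≤s z≤n) s<n)) z y z∈nh (∨-introˡ (relabel Ms (2s+1≡2[1+s]∸1 s) y∈M)))

  data TriangleShape (x y z : Fin N) : Set where
    through-hat  : ∀ s → 1 ≤ s → s ≤ n → card (Xh (2 * s)) ≡ 1 → y ∈ Xh (2 * s) → z ∈ Ls (2 * s + 1) →
                   TriangleShape x y z
    between-hats : ∀ s → 1 ≤ s → suc s ≤ n → x ∈ Xh (2 * s) → z ∈ Xh (2 * suc s) → TriangleShape x y z

  sorted-triangle-shape : ∀ {x y z} → x ∼ y → y ∼ z → x ∼ z → idx x < idx y → idx y < idx z →
                          TriangleShape x y z
  sorted-triangle-shape {x} {y} {z} x∼y y∼z x∼z x<y y<z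
    with sorted-triangle-consecutive x∼y y∼z x∼z x<y y<z | parity (idx x)
  ... | _ | inj₁ (zero , x≡0) = contradiction (subst (1 ≤_) x≡0 (proj₁ (range x))) λ ()
  ... | y≡ , z≡ | inj₁ (s@(suc _) , x≡2s) =
    let x∈h , z∈h = triangle-between-hats s (s≤s z≤n) s<n (idx≡⇒∈X x≡2s) (idx≡⇒∈X y≡2s+1) (idx≡⇒∈X z≡2[1+s]) x∼y y∼z
    in between-hats s (s≤s z≤n) s<n x∈h z∈h
    where
    y≡2s+1 : idx y ≡ 2 * s + 1
    y≡2s+1 = trans y≡ (trans (cong suc x≡2s) (+-comm 1 (2 * s)))
    z≡2[1+s] : idx z ≡ 2 * suc s
    z≡2[1+s] = trans z≡ (trans (cong suc (trans y≡ (cong suc x≡2s))) (sym (*-suc 2 s)))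
    s<n : suc s ≤ n
    s<n = 2a≤2b+1⇒a≤b (subst (_≤ 2 * n + 1) z≡2[1+s] (proj₂ (range z)))
  ... | y≡ , z≡ | inj₂ (t , x≡2t+1) =
    let one , y∈h , z∈L = triangle-through-hat (suc t) (s≤s z≤n) s≤n
                            (idx≡⇒∈X x≡2s∸1) (idx≡⇒∈X y≡2s) (idx≡⇒∈X z≡2s+1) x∼y y∼z x∼z
    in through-hat (suc t) (s≤s z≤n) s≤n one y∈h z∈L
    where
    x≡2s∸1 : idx x ≡ 2 * suc t ∸ 1
    x≡2s∸1 = trans x≡2t+1 (sym (cong (_∸ 1) (*-suc 2 t)))
    y≡2s : idx y ≡ 2 * suc t
    y≡2s = trans y≡ (trans (cong suc x≡2t+1) (sym (*-suc 2 t)))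
    z≡2s+1 : idx z ≡ 2 * suc t + 1
    z≡2s+1 = trans z≡ (trans (cong suc y≡2s) (+-comm 1 (2 * suc t)))
    s≤n : suc t ≤ n
    s≤n = *-cancelˡ-≤ 2 (+-cancelʳ-≤ 1 _ _ (subst (_≤ 2 * n + 1) z≡2s+1 (proj₂ (range z))))

  Hats-meet-triangles : ∀ K →
    (∀ s → 1 ≤ s → s ≤ n → card (Xh (2 * s)) ≡ 1 → Nonempty (Ls (2 * s + 1)) → K s ≡ true) →
    (∀ s → 1 ≤ s → suc s ≤ n → K s ≡ true ⊎ K (suc s) ≡ true) →
    MeetsAllTriangles G (Hats K n)
  Hats-meet-triangles K through between = sorted⇒MeetsAllTriangles idx ∼⇒idx≢ hit
    where
    hit : ∀ {x y z} → x ∼ y → y ∼ z → x ∼ z → idx x < idx y → idx y < idx z → Hit (Hats K n) x y z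
    hit x∼y y∼z x∼z x<y y<z with sorted-triangle-shape x∼y y∼z x∼z x<y y<z
    ... | through-hat s 1≤s s≤n one y∈h z∈L = inj₂ (inj₁ (∈-Hats 1≤s s≤n (through s 1≤s s≤n one (_ , z∈L)) y∈h))
    ... | between-hats s 1≤s s<n x∈h z∈h =
      [ (λ Ks → inj₁ (∈-Hats 1≤s (<⇒≤ s<n) Ks x∈h)) , (λ Ks′ → inj₂ (inj₂ (∈-Hats (s≤s z≤n) s<n Ks′ z∈h))) ]′
        (between s 1≤s s<n)

  Λ≤#singletons : ∀ {m} → IsΛ G m → m ≤ count singleton? n
  Λ≤#singletons (_ , minimal) =
    ≤-trans (minimal (Hats singleton? n) (Hats-meet-triangles singleton? (λ _ _ _ one _ → ≡⇒≡ᵇ-true one) one-of-two))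
            (card-Hats n λ _ _ _ single → ≤-reflexive (≡ᵇ-true⇒≡ single))
    where
    one-of-two : ∀ s → 1 ≤ s → suc s ≤ n → singleton? s ≡ true ⊎ singleton? (suc s) ≡ true
    one-of-two s 1≤s s<n = map ≡⇒≡ᵇ-true (≡⇒≡ᵇ-true ∘ trans (cong (card ∘ Xh) (sym (2s+2≡2[1+s] s))))
                                        (proj₂ (P1 s 1≤s (<⇒≤ s<n)))

  Λ≤n : ∀ {m} → IsΛ G m → m ≤ n
  Λ≤n Λ = ≤-trans (Λ≤#singletons Λ) (count-≤ singleton? n)

  Λ≥n⇒singleton : ∀ {m} → IsΛ G m → n ≤ m → ∀ {j} → 1 ≤ j → j ≤ n → card (Xh (2 * j)) ≡ 1
  Λ≥n⇒singleton Λ n≤m = ≡ᵇ-true⇒≡ ∘₂ count-full {singleton?} n (≤-trans n≤m (Λ≤#singletons Λ))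

  hat-nonempty : ∀ k → 1 ≤ k → k ≤ n → Nonempty (Xh (2 * k))
  hat-nonempty k 1≤k k≤n = card>0⇒nonempty (proj₁ (P1 k 1≤k k≤n))

  matched-nonempty : ∀ {S S′} → Matched G S S′ → Nonempty S′ → Nonempty S
  matched-nonempty (_ , _ , _ , unique) (v , v∈) = let w , w∈ , _ = unique v v∈ in w , w∈

  -- By P5(4), M₂ₖ₊₁ is matched with the hat set beyond whichever of X̂₂ₖ, X̂₂ₖ₊₂ is a singleton.
  middle-nonempty : ∀ k → 1 ≤ k → suc k ≤ n → Nonempty (Ms (2 * k + 1))
  middle-nonempty k 1≤k k<n with proj₂ (P1 k 1≤k (<⇒≤ k<n))
  ... | inj₁ one = matched-nonempty (proj₂ (proj₂ (proj₂ (proj₂ (P5 k 1≤k (<⇒≤ k<n) one)))) k<n)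
                                    (subst (Nonempty ∘ Xh) (sym (2s+2≡2[1+s] k)) (hat-nonempty (suc k) (s≤s z≤n) k<n))
  ... | inj₂ one = let v , v∈ = matched-nonempty (proj₁ (proj₂ (proj₂ (proj₂ P5ʳ))) (s≤s 1≤k))
                                                 (subst (Nonempty ∘ Xh) (sym (cong (_∸ 2) (*-suc 2 k))) (hat-nonempty k 1≤k (<⇒≤ k<n)))
                   in v , relabel Ms (sym (2s+1≡2[1+s]∸1 k)) v∈
    where
    P5ʳ = P5 (suc k) (s≤s z≤n) k<n (subst (λ i → card (Xh i) ≡ 1) (2s+2≡2[1+s] k) one)

  Low High : Fin N → Set
  Low v  = v ∈ X 1 ⊎ v ∈ Xh 4
  High v = v ∈ Xh 6 ⊎ v ∈ X 9

  low∼high : ∀ {u v} → Low u → High v → u ∼ v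
  low∼high (inj₁ u∈) (inj₁ v∈) = adjacent 1 6 u∈ (Xh⊆X v∈)
  low∼high (inj₁ u∈) (inj₂ v∈) = adjacent 1 9 u∈ v∈
  low∼high (inj₂ u∈) (inj₁ v∈) = adjacent-hats 4 6 u∈ v∈
  low∼high (inj₂ u∈) (inj₂ v∈) = adjacent 4 9 (Xh⊆X u∈) v∈

  low≁low : ∀ {u v} → Low u → Low v → ¬ u ∼ v
  low≁low (inj₁ u∈) (inj₁ v∈) = layer-stable 1 u∈ v∈
  low≁low (inj₁ u∈) (inj₂ v∈) = nonadjacent 1 4 u∈ (Xh⊆X v∈)
  low≁low (inj₂ u∈) (inj₁ v∈) = nonadjacent 1 4 v∈ (Xh⊆X u∈) ∘ ∼-sym
  low≁low (inj₂ u∈) (inj₂ v∈) = layer-stable 4 (Xh⊆X u∈) (Xh⊆X v∈)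

  high≁high : ∀ {u v} → High u → High v → ¬ u ∼ v
  high≁high (inj₁ u∈) (inj₁ v∈) = layer-stable 6 (Xh⊆X u∈) (Xh⊆X v∈)
  high≁high (inj₁ u∈) (inj₂ v∈) = nonadjacent 6 9 (Xh⊆X u∈) v∈
  high≁high (inj₂ u∈) (inj₁ v∈) = nonadjacent 6 9 (Xh⊆X v∈) u∈ ∘ ∼-sym
  high≁high (inj₂ u∈) (inj₂ v∈) = layer-stable 9 u∈ v∈

  X₁₃≁low : ∀ {e v} → e ∈ X 13 → Low v → ¬ e ∼ v
  X₁₃≁low e∈ (inj₁ v∈) = nonadjacent 1 13 v∈ e∈ ∘ ∼-sym
  X₁₃≁low e∈ (inj₂ v∈) = nonadjacent 4 13 (Xh⊆X v∈) e∈ ∘ ∼-sym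

  X₁₃≁high : ∀ {e v} → e ∈ X 13 → High v → ¬ e ∼ v
  X₁₃≁high e∈ (inj₁ v∈) = nonadjacent 6 13 (Xh⊆X v∈) e∈ ∘ ∼-sym
  X₁₃≁high e∈ (inj₂ v∈) = nonadjacent 9 13 v∈ e∈ ∘ ∼-sym

  low-pair : 2 ≤ n → ∃[ u ] ∃[ v ] u ≢ v × Low u × Low v
  low-pair 2≤n with nonempty? (X 1)
  ... | inj₁ (u , u∈) = let v , v∈ = hat-nonempty 2 (s≤s z≤n) 2≤n
                        in u , v , layer-distinct 1 4 u∈ (Xh⊆X v∈) , inj₁ u∈ , inj₂ v∈
  ... | inj₂ X₁-empty = let u , v , u≢v , u∈ , v∈ = card>1⇒two (proj₂ (proj₁ P7-3 λ v v∈R → X₁-empty v (Rs⊆X v∈R)))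
                        in u , v , u≢v , inj₂ u∈ , inj₂ v∈

  high-pair : 4 ≤ n → ∃[ u ] ∃[ v ] u ≢ v × High u × High v
  high-pair 4≤n with nonempty? (X 9)
  ... | inj₁ (v , v∈) = let u , u∈ = hat-nonempty 3 (s≤s z≤n) (≤-trans (n≤1+n 3) 4≤n)
                        in u , v , layer-distinct 6 9 (Xh⊆X u∈) v∈ , inj₁ u∈ , inj₂ v∈
  ... | inj₂ X₉-empty = let u , v , u≢v , u∈ , v∈ = card>1⇒two two-hats in u , v , u≢v , inj₁ u∈ , inj₁ v∈
    where
    4≡n : 4 ≡ n
    4≡n = [ (λ 4<n → let v , v∈ = middle-nonempty 4 (s≤s z≤n) 4<n in ⊥-elim (X₉-empty v (Ms⊆X v∈))) , id ]′
            (m≤n⇒m<n∨m≡n 4≤n)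
    two-hats : 1 < card (Xh 6)
    two-hats = proj₂ (subst (λ k → IsEmpty (Ls (2 * k + 1)) → 2 ≤ k × 1 < card (Xh (2 * k ∸ 2))) (sym 4≡n) (proj₂ P7-3)
                            λ v v∈L → X₉-empty v (Ls⊆X v∈L))

  low-high-C4 : 4 ≤ n → Σ (InducedC4 G) λ c → let open InducedC4 c in Low a₁ × Low a₂ × High b₁ × High b₂
  low-high-C4 4≤n =
    let u₁ , u₂ , u₁≢u₂ , l₁ , l₂ = low-pair (≤-trans (s≤s (s≤s z≤n)) 4≤n)
        v₁ , v₂ , v₁≢v₂ , h₁ , h₂ = high-pair 4≤n
    in record { a₁ = u₁ ; a₂ = u₂ ; b₁ = v₁ ; b₂ = v₂ ; a₁≢a₂ = u₁≢u₂ ; b₁≢b₂ = v₁≢v₂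
              ; a₁∼b₁ = low∼high l₁ h₁ ; a₁∼b₂ = low∼high l₁ h₂ ; a₂∼b₁ = low∼high l₂ h₁ ; a₂∼b₂ = low∼high l₂ h₂
              ; a₁≁a₂ = low≁low l₁ l₂ ; b₁≁b₂ = high≁high h₁ h₂ }
       , l₁ , l₂ , h₁ , h₂

-- Bicoloured induced C₄ and C₄ + K₁

module Patterns {G : Graph} (T : ThreeColoring G) {n : ℕ} {idx : Fin (Graph.N G) → ℕ} {hat side}
                (gp : IsGoodPartition G n idx hat side)
                (σ : Fin 3 → Fin 3) (σ-injective : Injective _≡_ _≡_ σ)
                (σ-colours : ∀ k v → Parts.Acl idx hat side (toℕ k) v ≡ colour T (σ k) v) where
  open Adjacency G
  open Layers idx hat side
  open GoodPartition gp
  open IsGoodPartition gp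
  open Colours T idx hat side σ σ-injective σ-colours

  private
    A₁∪A₀ = bicolour (fs fz) fz λ ()

    low∈A₁∪A₀ : ∀ {v} → Low v → v ∈ pairUnion T (proj₁ A₁∪A₀)
    low∈A₁∪A₀ = [ (λ v∈ → proj₂ A₁∪A₀ v∈ (inj₁ refl)) , (λ v∈ → proj₂ A₁∪A₀ (Xh⊆X v∈) (inj₁ refl)) ]′

    high∈A₁∪A₀ : ∀ {v} → High v → v ∈ pairUnion T (proj₁ A₁∪A₀)
    high∈A₁∪A₀ = [ (λ v∈ → proj₂ A₁∪A₀ (Xh⊆X v∈) (inj₂ refl)) , (λ v∈ → proj₂ A₁∪A₀ v∈ (inj₂ refl)) ]′

  bicoloured-C4 : 4 ≤ n → HasBicoloredC4 T
  bicoloured-C4 4≤n =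
    let c , l₁ , l₂ , h₁ , h₂ = low-high-C4 4≤n
    in InducedC4⇒HasBicoloredC4 T c (proj₁ A₁∪A₀) (low∈A₁∪A₀ l₁ , low∈A₁∪A₀ l₂ , high∈A₁∪A₀ h₁ , high∈A₁∪A₀ h₂)

  bicoloured-C4K1-from-X₁₃ : 4 ≤ n → Nonempty (X 13) → HasBicoloredC4K1 T
  bicoloured-C4K1-from-X₁₃ 4≤n (e , e∈) =
    let c , l₁ , l₂ , h₁ , h₂ = low-high-C4 4≤n
    in InducedC4⇒HasBicoloredC4K1 T c (proj₁ A₁∪A₀)
         (low∈A₁∪A₀ l₁ , low∈A₁∪A₀ l₂ , high∈A₁∪A₀ h₁ , high∈A₁∪A₀ h₂)
         (X₁₃≁low e∈ l₁) (X₁₃≁low e∈ l₂) (X₁₃≁high e∈ h₁) (X₁₃≁high e∈ h₂) (proj₂ A₁∪A₀ e∈ (inj₁ refl))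

  bicoloured-C4K1-from-X₁ : ∀ {e a b c d} → e ∈ X 1 → a ∈ X 5 → b ∈ Xh 8 → c ∈ Xh 10 → d ∈ Xh 10 → c ≢ d →
                            HasBicoloredC4K1 T
  bicoloured-C4K1-from-X₁ {e} {a} {b} {c} {d} e∈ a∈ b∈h c∈h d∈h c≢d =
    InducedC4⇒HasBicoloredC4K1 T C4 (proj₁ A₂∪A₁)
      (in-pair a∈ (inj₁ refl) , in-pair b∈ (inj₁ refl) , in-pair c∈ (inj₂ refl) , in-pair d∈ (inj₂ refl))
      (nonadjacent 1 5 e∈ a∈) (nonadjacent 1 8 e∈ b∈) (nonadjacent 1 10 e∈ c∈) (nonadjacent 1 10 e∈ d∈)
      (in-pair e∈ (inj₂ refl))
    where
    b∈ = Xh⊆X b∈h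
    c∈ = Xh⊆X c∈h
    d∈ = Xh⊆X d∈h
    A₂∪A₁ = bicolour (fs (fs fz)) (fs fz) λ ()
    in-pair = proj₂ A₂∪A₁
    C4 : InducedC4 G
    C4 = record { a₁ = a ; a₂ = b ; b₁ = c ; b₂ = d ; a₁≢a₂ = layer-distinct 5 8 a∈ b∈ ; b₁≢b₂ = c≢d
                ; a₁∼b₁ = adjacent 5 10 a∈ c∈ ; a₁∼b₂ = adjacent 5 10 a∈ d∈
                ; a₂∼b₁ = adjacent-hats 8 10 b∈h c∈h ; a₂∼b₂ = adjacent-hats 8 10 b∈h d∈h
                ; a₁≁a₂ = nonadjacent 5 8 a∈ b∈ ; b₁≁b₂ = layer-stable 10 c∈ d∈ }

  bicoloured-C4K1-from-L₅ : 3 ≤ n → card (Xh 4) ≡ 1 →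
                            ∀ {e a b c d} → e ∈ Ls 5 → a ∈ Ms 3 → b ∈ Xh 6 → c ∈ Xh 8 → d ∈ X 11 →
                            HasBicoloredC4K1 T
  bicoloured-C4K1-from-L₅ 3≤n one {e} {a} {b} {c} {d} e∈L a∈M b∈h c∈h d∈ =
    InducedC4⇒HasBicoloredC4K1 T C4 (proj₁ A₀∪A₂)
      (in-pair a∈ (inj₁ refl) , in-pair b∈ (inj₁ refl) , in-pair c∈ (inj₂ refl) , in-pair d∈ (inj₂ refl))
      e≁a e≁b (nonadjacent 5 8 e∈ c∈) (nonadjacent 5 11 e∈ d∈) (in-pair e∈ (inj₂ refl))
    where
    a∈ = Ms⊆X a∈M
    b∈ = Xh⊆X b∈h
    c∈ = Xh⊆X c∈h
    e∈ = Ls⊆X e∈L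
    A₀∪A₂ = bicolour fz (fs (fs fz)) λ ()
    in-pair = proj₂ A₀∪A₂
    -- P5(1) for the singleton X̂₄: every edge between M₃ ∪ R₃ and L₅ ∪ M₅ joins R₃ to L₅.
    e≁a : ¬ e ∼ a
    e≁a e∼a = Ms∩Rs a∈M (proj₁ (proj₂ (proj₁ (P5 2 (s≤s z≤n) (≤-trans (n≤1+n 2) 3≤n) one))
                                  a e (∨-introˡ a∈M) (∨-introˡ e∈L) (∼-sym e∼a)))
    e≁b : ¬ e ∼ b
    e≁b e∼b = proj₁ (P4 3 (s≤s z≤n) 3≤n) b e b∈ (∨-introˡ e∈L) (∼-sym e∼b)
    C4 : InducedC4 G
    C4 = record { a₁ = a ; a₂ = b ; b₁ = c ; b₂ = d ; a₁≢a₂ = layer-distinct 3 6 a∈ b∈ ; b₁≢b₂ = layer-distinct 8 11 c∈ d∈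
                ; a₁∼b₁ = adjacent 3 8 a∈ c∈ ; a₁∼b₂ = adjacent 3 11 a∈ d∈
                ; a₂∼b₁ = adjacent-hats 6 8 b∈h c∈h ; a₂∼b₂ = adjacent 6 11 b∈ d∈
                ; a₁≁a₂ = nonadjacent 3 6 a∈ b∈ ; b₁≁b₂ = nonadjacent 8 11 c∈ d∈ }

module _ {G : Graph} (T : ThreeColoring G) {idx : Fin (Graph.N G) → ℕ} {hat side}
         (σ : Fin 3 → Fin 3) (σ-injective : Injective _≡_ _≡_ σ)
         (σ-colours : ∀ k v → Parts.Acl idx hat side (toℕ k) v ≡ colour T (σ k) v) where
  open Layers idx hat side

  module _ {n : ℕ} (gp : IsGoodPartition G n idx hat side) where
    open GoodPartition gp
    open Patterns T gp σ σ-injective σ-colours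

    C4K1-when-n≥7 : 7 ≤ n → HasBicoloredC4K1 T
    C4K1-when-n≥7 7≤n =
      let e , e∈ = middle-nonempty 6 (s≤s z≤n) 7≤n
      in bicoloured-C4K1-from-X₁₃ (≤-trans (m≤m+n 4 3) 7≤n) (e , Ms⊆X e∈)

  module _ (gp : IsGoodPartition G 6 idx hat side) where
    open GoodPartition gp
    open IsGoodPartition gp
    open Patterns T gp σ σ-injective σ-colours

    C4K1-when-n≡6 : 5 ≤ count singleton? 6 → HasBicoloredC4K1 T
    C4K1-when-n≡6 5≤# with nonempty? (Ls 13) | nonempty? (X 1)
    ... | inj₁ (e , e∈) | _ = bicoloured-C4K1-from-X₁₃ (m≤m+n 4 2) (e , Ls⊆X e∈)
    ... | inj₂ L₁₃-empty | inj₁ (e , e∈) =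
      let c , d , c≢d , c∈ , d∈ = card>1⇒two (proj₂ (proj₂ P7-3 L₁₃-empty))
          a , a∈ = middle-nonempty 2 (s≤s z≤n) (m≤m+n 3 3)
          b , b∈ = hat-nonempty 4 (s≤s z≤n) (m≤m+n 4 2)
      in bicoloured-C4K1-from-X₁ e∈ (Ms⊆X a∈) b∈ c∈ d∈ c≢d
    ... | inj₂ L₁₃-empty | inj₂ X₁-empty =
      contradiction (≤-trans 5≤# (count-avoiding {singleton?} {2} {5} X̂₄-not-singleton X̂₁₀-not-singleton 6)) (<⇒≱ ≤-refl)
      where
      X̂₄-not-singleton : singleton? 2 ≡ false
      X̂₄-not-singleton = >1⇒≡ᵇ1-false (proj₂ (proj₁ P7-3 λ v v∈R → X₁-empty v (Rs⊆X v∈R)))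
      X̂₁₀-not-singleton : singleton? 5 ≡ false
      X̂₁₀-not-singleton = >1⇒≡ᵇ1-false (proj₂ (proj₂ P7-3 L₁₃-empty))

  module _ (gp : IsGoodPartition G 5 idx hat side) where
    open GoodPartition gp
    open IsGoodPartition gp
    open Patterns T gp σ σ-injective σ-colours

    -- Without L₅ no triangle needs X̂₄, so the other four singleton hats meet every triangle.
    Λ≤4-if-L₅-empty : ∀ {m} → IsΛ G m → 5 ≤ m → IsEmpty (Ls 5) → m ≤ 4
    Λ≤4-if-L₅-empty Λ@(_ , minimal) 5≤m L₅-empty =
      ≤-trans (minimal (Hats skip-2 5) (Hats-meet-triangles skip-2 through between))
              (card-Hats {skip-2} 5 λ _ 1≤j j≤5 _ → ≤-reflexive (Λ≥n⇒singleton Λ 5≤m 1≤j j≤5))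
      where
      skip-2 : ℕ → Bool
      skip-2 j = not (j ≡ᵇ 2)
      through : ∀ s → 1 ≤ s → s ≤ 5 → card (Xh (2 * s)) ≡ 1 → Nonempty (Ls (2 * s + 1)) → skip-2 s ≡ true
      through s _ _ _ (v , v∈) with s ≡ᵇ 2 in s≡2
      ... | true  = contradiction (relabel Ls (cong (λ k → 2 * k + 1) (≡ᵇ-true⇒≡ {s} s≡2)) v∈) (L₅-empty v)
      ... | false = refl
      between : ∀ s → 1 ≤ s → suc s ≤ 5 → skip-2 s ≡ true ⊎ skip-2 (suc s) ≡ true
      between 0                   _ _ = inj₁ refl
      between 1                   _ _ = inj₁ refl
      between 2                   _ _ = inj₂ refl
      between (suc (suc (suc _))) _ _ = inj₁ refl

    C4K1-when-n≡5 : ∀ {m} → IsΛ G m → 5 ≤ m → HasBicoloredC4K1 T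
    C4K1-when-n≡5 Λ 5≤m with nonempty? (Ls 11) | nonempty? (Ls 5)
    ... | inj₂ L₁₁-empty | _ =
      contradiction (Λ≥n⇒singleton Λ 5≤m (s≤s z≤n) (m≤m+n 4 1)) (>⇒≢ (proj₂ (proj₂ P7-3 L₁₁-empty)))
    ... | inj₁ _ | inj₂ L₅-empty = contradiction (Λ≤4-if-L₅-empty Λ 5≤m L₅-empty) (<⇒≱ 5≤m)
    ... | inj₁ (d , d∈) | inj₁ (e , e∈) =
      let a , a∈ = middle-nonempty 1 (s≤s z≤n) (m≤m+n 2 3)
          b , b∈ = hat-nonempty 3 (s≤s z≤n) (m≤m+n 3 2)
          c , c∈ = hat-nonempty 4 (s≤s z≤n) (m≤m+n 4 1)
      in bicoloured-C4K1-from-L₅ (m≤m+n 3 2) (Λ≥n⇒singleton Λ 5≤m (s≤s z≤n) (m≤m+n 2 3)) e∈ a∈ b∈ c∈ (Ls⊆X d∈)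

  bicoloured-C4K1 : ∀ {n} → IsGoodPartition G n idx hat side → ∀ {m} → IsΛ G m → 5 ≤ m → HasBicoloredC4K1 T
  bicoloured-C4K1 gp Λ 5≤m with m≤n⇒m<n∨m≡n (≤-trans 5≤m (GoodPartition.Λ≤n gp Λ))
  ... | inj₂ refl = C4K1-when-n≡5 gp Λ 5≤m
  ... | inj₁ 6≤n with m≤n⇒m<n∨m≡n 6≤n
  ...   | inj₂ refl = C4K1-when-n≡6 gp (≤-trans 5≤m (GoodPartition.Λ≤#singletons gp Λ))
  ...   | inj₁ 7≤n  = C4K1-when-n≥7 gp 7≤n

lemma4p3 : (G : Graph) (T : ThreeColoring G) → CanonicallyColoredPoT G T →
           (m : ℕ) → IsΛ G m →
           m ≤ 3 ⊎ (m ≡ 4 × HasBicoloredC4 T) ⊎ (5 ≤ m × HasBicoloredC4K1 T)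
lemma4p3 G T (n , idx , hat , side , gp , σ , σ-injective , σ-colours) m Λ with m ≤? 3 | m ≟ 4
... | yes m≤3 | _        = inj₁ m≤3
... | no _    | yes refl = inj₂ (inj₁ (refl , Patterns.bicoloured-C4 T gp σ σ-injective σ-colours (GoodPartition.Λ≤n gp Λ)))
... | no m≰3  | no m≢4   = inj₂ (inj₂ (5≤m , bicoloured-C4K1 T σ σ-injective σ-colours gp Λ 5≤m))
  where
  5≤m : 5 ≤ m
  5≤m = ≤∧≢⇒< (≰⇒> m≰3) (m≢4 ∘ sym)
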